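{- Let $\mathbb{K}_{c,m}^r$ be an $r$-uniform star-hypergraph with $m\ge 2$ edges and centre of size $c$. Then $\lambda(\mathbb{K}_{c,m}^r)=m(r-c)+2c-1$.
   Context: A hypergraph $\mathbb{H}=(V,E)$ consists of a finite vertex set $V$ and a family $E$ of subsets of $V$ (edges); all hypergraphs are simple: every edge has at least two elements and no edge contains another. An $r$-uniform hypergraph (all edges of size $r$) is a star-hypergraph if there is a set $\mathcal{C}\subset V$ (the centre) such that $e_i\cap e_j=\mathcal{C}$ for all distinct edges $e_i,e_j$; with $|E|=m$ and $|\mathcal{C}|=c$ it is denoted $\mathbb{K}_{c,m}^r$. An $L(2,1)$-colouring of $\mathbb{H}$ is a map $f:V\to\mathbb{Z}_{\ge0}$ such that $|f(u)-f(v)|\ge 2$ whenever $u\neq v$ lie in a common edge, and $|f(u)-f(v)|\ge 1$ whenever $u\ne v$ and there exist edges $e_1\ni v$, $e_2\ni u$ with $(e_1\cap e_2)\setminus\{u,v\}\neq\emptyset$. The span of $f$ is $\max f-\min f$, and $\lambda(\mathbb{H})$ is the minimum span of an $L(2,1)$-colouring of $\mathbb{H}$. -}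

module Defs where

open import Data.Nat using (ℕ; _≤_; _⊔_; _⊓_; _∸_; ∣_-_∣)
open import Data.Fin using (Fin)
open import Data.Fin.Subset using (Subset; _∈_; _⊆_; _∩_; ∣_∣)
open import Data.List using (List; foldr; map; allFin)
open import Data.Product using (Σ; _×_)
open import Relation.Binary.PropositionalEquality using (_≡_; _≢_)
open import Relation.Nullary using (¬_)

record Hypergraph : Set where
  field
    nV   : ℕ
    nE   : ℕ
    edge : Fin nE → Subset nV
open Hypergraph public

Simple : Hypergraph → Set
Simple H = (∀ i → 2 ≤ ∣ edge H i ∣)
         × (∀ i j → i ≢ j → ¬ (edge H i ⊆ edge H j))

Uniform : Hypergraph → ℕ → Set
Uniform H r = ∀ i → ∣ edge H i ∣ ≡ r

IsStar : Hypergraph → ℕ → Set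
IsStar H c = Σ (Subset (nV H)) λ C →
  (∣ C ∣ ≡ c) × (∀ i j → i ≢ j → edge H i ∩ edge H j ≡ C)

IsL21 : (H : Hypergraph) → (Fin (nV H) → ℕ) → Set
IsL21 H f =
  (∀ u v → u ≢ v → ∀ i → u ∈ edge H i → v ∈ edge H i → 2 ≤ ∣ f u - f v ∣)
  × (∀ u v → u ≢ v → ∀ i j w → v ∈ edge H i → u ∈ edge H j →
       w ∈ edge H i → w ∈ edge H j → w ≢ u → w ≢ v → 1 ≤ ∣ f u - f v ∣)

maxVal : ∀ {n} → (Fin n → ℕ) → ℕ
maxVal {n} f = foldr _⊔_ 0 (map f (allFin n))

minVal : ∀ {n} → (Fin n → ℕ) → ℕ
minVal {n} f = foldr _⊓_ (maxVal f) (map f (allFin n))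

span : ∀ {n} → (Fin n → ℕ) → ℕ
span f = maxVal f ∸ minVal f

IsLambda : Hypergraph → ℕ → Set
IsLambda H k =
  (Σ (Fin (nV H) → ℕ) λ f → IsL21 H f × span f ≡ k)
  × (∀ f → IsL21 H f → k ≤ span f)

-- Call the vertices of an edge outside the centre C its private vertices; each edge has
-- r − c of them and they lie in no other edge.
-- Upper bound: colour the centre with 0, 2, …, 2c − 2 and the private vertex of rank k
-- in edge i with 2c + i + m k.  Inside an edge the private colours are m ≥ 2 apart and
-- lie above the centre colours, all colours are distinct, and the largest is
-- m (r − c) + 2c − 1.
-- Lower bound: an L(2,1)-colouring f is injective on the c + m (r − c) vertices of the
-- edges, since two private vertices always share a centre vertex.  Fix a private vertex
-- p₀ (edges are not nested); for each centre vertex a the value f a ± 1 on the side of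
-- f p₀ is used by no vertex, and these c values are distinct.  So 2c + m (r − c)
-- distinct values lie between min f and max f.
module Submission where

open import Defs
open import Data.Nat
open import Data.Nat.Properties
open import Data.Nat.DivMod using (_%_; [m+kn]%n≡m%n; m<n⇒m%n≡m)
open import Data.Bool using (true; false)
open import Data.Vec using ([]; _∷_; here; there)
open import Data.Fin using (Fin; zero; suc; toℕ; fromℕ<)
import Data.Fin.Properties as Fin
open import Data.Fin.Subset using (Subset; _∈_; _∉_; _⊆_; _∩_; _─_; ∣_∣; Nonempty; Empty)
open import Data.Fin.Subset.Properties
  using (_∈?_; nonempty?; Empty-unique; ∣⊥∣≡0; x∈p∩q⁺; p∩q⊆p; ∩-assoc; ∩-idem; p─q⊆p; x∈p∧x∉q⇒x∈p─q)
open import Data.List using (List; []; _∷_; _++_; map; length; foldr; concat; tabulate; allFin; applyUpTo)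
open import Data.List.Properties using (length-++; length-map; length-applyUpTo; foldr-preservesᵇ)
open import Data.List.Relation.Unary.All as All using (All; []; _∷_)
import Data.List.Relation.Unary.All.Properties as All
open import Data.List.Relation.Unary.Any as Any using ()
import Data.List.Relation.Unary.AllPairs.Properties as AllPairs
open import Data.List.Relation.Unary.Unique.Propositional using (Unique; []; _∷_)
import Data.List.Relation.Unary.Unique.Propositional.Properties as Unique
open import Data.List.Relation.Binary.Disjoint.Propositional using (Disjoint)
open import Data.List.Membership.Propositional using () renaming (_∈_ to _∈ˡ_)
open import Data.List.Membership.Propositional.Properties
  using (∈-∃++; ∈-++⁻; ∈-++⁺ˡ; ∈-++⁺ʳ; ∈-map⁻; ∈-map⁺; ∈-allFin; ∈-applyUpTo⁺; ∈-concat⁻′; ∈-tabulate⁻)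
open import Data.Product using (∃; _×_; _,_; proj₁; proj₂)
open import Data.Sum using (_⊎_; inj₁; inj₂)
open import Data.Empty using (⊥-elim)
open import Function using (_∘_)
open import Relation.Binary.PropositionalEquality
open import Relation.Nullary using (¬_; yes; no; contradiction)
open import Relation.Nullary.Decidable using (decidable-stable; toSum)

private variable a b k n s t x y lo hi : ℕ

-- Distances between natural numbers

1≤∣m-n∣⇒m≢n : 1 ≤ ∣ x - y ∣ → x ≢ y
1≤∣m-n∣⇒m≢n {x} 1≤∣x-x∣ refl = contradiction (subst (1 ≤_) (∣n-n∣≡0 x) 1≤∣x-x∣) λ ()

m≢n⇒1≤∣m-n∣ : x ≢ y → 1 ≤ ∣ x - y ∣
m≢n⇒1≤∣m-n∣ x≢y = n≢0⇒n>0 (x≢y ∘ ∣m-n∣≡0⇒m≡n)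

2≤∣m-n∣⇒m≢n : 2 ≤ ∣ x - y ∣ → x ≢ y
2≤∣m-n∣⇒m≢n = 1≤∣m-n∣⇒m≢n ∘ ≤-trans (s≤s z≤n)

2≤∣m-n∣⇒2+m≤n⊎2+n≤m : 2 ≤ ∣ x - y ∣ → 2 + x ≤ y ⊎ 2 + y ≤ x
2≤∣m-n∣⇒2+m≤n⊎2+n≤m {zero}  {y}     d = inj₁ d
2≤∣m-n∣⇒2+m≤n⊎2+n≤m {suc x} {zero}  d = inj₂ d
2≤∣m-n∣⇒2+m≤n⊎2+n≤m {suc x} {suc y} d with 2≤∣m-n∣⇒2+m≤n⊎2+n≤m {x} {y} d
... | inj₁ le = inj₁ (s≤s le)
... | inj₂ le = inj₂ (s≤s le)

2+m≤n⇒2≤∣m-n∣ : 2 + x ≤ y → 2 ≤ ∣ x - y ∣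
2+m≤n⇒2≤∣m-n∣ {x} {y} le = subst (2 ≤_) (sym (m≤n⇒∣m-n∣≡n∸m (≤-trans (m≤n+m x 2) le)))
  (m+n≤o⇒m≤o∸n 2 le)

2≤∣k*m-k*n∣ : 2 ≤ k → a ≢ b → 2 ≤ ∣ k * a - k * b ∣
2≤∣k*m-k*n∣ {k} {a} {b} 2≤k a≢b = subst (2 ≤_) (*-distribˡ-∣-∣ k a b)
  (subst (_≤ k * ∣ a - b ∣) (*-identityʳ 2) (*-mono-≤ 2≤k (m≢n⇒1≤∣m-n∣ a≢b)))

suc[m+[2n∸1]]≡m+2n : ∀ m {n} → 1 ≤ n → suc (m + (2 * n ∸ 1)) ≡ m + 2 * n
suc[m+[2n∸1]]≡m+2n m {suc n} _ = sym (+-suc m (2 * suc n ∸ 1))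

∣1+n-n∣≡1 : ∀ n → ∣ suc n - n ∣ ≡ 1
∣1+n-n∣≡1 zero    = refl
∣1+n-n∣≡1 (suc n) = ∣1+n-n∣≡1 n

towards : ℕ → ℕ → ℕ
towards x b with x <? b
... | yes _ = suc x
... | no  _ = pred x

towards-spec : 2 ≤ ∣ x - b ∣ →
  (towards x b ≡ suc x × towards x b < b) ⊎ (suc (towards x b) ≡ x × b < towards x b)
towards-spec {x} {b} d with x <? b | 2≤∣m-n∣⇒2+m≤n⊎2+n≤m d
... | yes _   | inj₁ 2+x≤b       = inj₁ (refl , 2+x≤b)
... | no  x≮b | inj₁ 2+x≤b       = contradiction (≤-trans (n≤1+n _) 2+x≤b) x≮b
... | yes x<b | inj₂ 2+b≤x       = contradiction (≤-trans (n≤1+n _) 2+b≤x) (<-asym x<b)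
... | no  _   | inj₂ (s≤s 1+b≤x) = inj₂ (refl , 1+b≤x)

∣towards-m∣≡1 : 2 ≤ ∣ x - b ∣ → ∣ towards x b - x ∣ ≡ 1
∣towards-m∣≡1 {x} {b} d with towards-spec d
... | inj₁ (t≡1+x , _) = subst (λ t → ∣ t - x ∣ ≡ 1) (sym t≡1+x) (∣1+n-n∣≡1 x)
... | inj₂ (1+t≡x , _) = subst (λ z → ∣ w - z ∣ ≡ 1) 1+t≡x (trans (∣-∣-comm w (suc w)) (∣1+n-n∣≡1 w))
  where w = towards x b

towards-≢ : 2 ≤ ∣ x - b ∣ → ∣ x - y ∣ ≢ 1 → towards x b ≢ y
towards-≢ {x} {b} d ∣x-y∣≢1 refl = ∣x-y∣≢1 (trans (∣-∣-comm x (towards x b)) (∣towards-m∣≡1 {x} {b} d))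

towards-between : 2 ≤ ∣ x - b ∣ → x ⊓ b ≤ towards x b × towards x b ≤ x ⊔ b
towards-between {x} {b} d with towards-spec d
... | inj₁ (t≡1+x , t<b) =
  ≤-trans (m⊓n≤m x b) (≤-trans (n≤1+n x) (≤-reflexive (sym t≡1+x))) ,
  ≤-trans (<⇒≤ t<b) (m≤n⊔m x b)
... | inj₂ (1+t≡x , b<t) =
  ≤-trans (m⊓n≤n x b) (<⇒≤ b<t) ,
  ≤-trans (≤-trans (n≤1+n _) (≤-reflexive 1+t≡x)) (m≤m⊔n x b)

towards-injective : 2 ≤ ∣ x - b ∣ → 2 ≤ ∣ y - b ∣ → x ≢ y → towards x b ≢ towards y b
towards-injective dx dy x≢y tx≡ty with towards-spec dx | towards-spec dy
... | inj₁ (tx≡1+x , _)   | inj₁ (ty≡1+y , _)   = x≢y (suc-injective (trans (sym tx≡1+x) (trans tx≡ty ty≡1+y)))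
... | inj₂ (1+tx≡x , _)   | inj₂ (1+ty≡y , _)   = x≢y (trans (sym 1+tx≡x) (trans (cong suc tx≡ty) 1+ty≡y))
... | inj₁ (_ , tx<b)     | inj₂ (_ , b<ty)     = <-irrefl tx≡ty (<-trans tx<b b<ty)
... | inj₂ (_ , b<tx)     | inj₁ (_ , ty<b)     = <-irrefl (sym tx≡ty) (<-trans ty<b b<tx)

digits-injective : s < k → t < k → s + k * a ≡ t + k * b → s ≡ t × a ≡ b
digits-injective {s} {k@(suc _)} {t} {a} {b} s<k t<k eq = s≡t , a≡b
  where
  digit : ∀ {s} a → s < k → (s + k * a) % k ≡ s
  digit {s} a s<k = begin
    (s + k * a) % k ≡⟨ cong (λ z → (s + z) % k) (*-comm k a) ⟩
    (s + a * k) % k ≡⟨ [m+kn]%n≡m%n s a k ⟩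
    s % k           ≡⟨ m<n⇒m%n≡m s<k ⟩
    s               ∎
    where open ≡-Reasoning
  s≡t : s ≡ t
  s≡t = trans (sym (digit a s<k)) (trans (cong (_% k) eq) (digit b t<k))
  a≡b : a ≡ b
  a≡b = *-cancelˡ-≡ a b k (+-cancelˡ-≡ t _ _ (subst (λ z → z + k * a ≡ t + k * b) s≡t eq))

digits-< : s < k → a < b → s + k * a < k * b
digits-< {s} {k} {a} {b} s<k a<b = begin-strict
  s + k * a   <⟨ +-monoˡ-< (k * a) s<k ⟩
  k + k * a   ≡⟨ *-suc k a ⟨
  k * suc a   ≤⟨ *-monoʳ-≤ k a<b ⟩
  k * b       ∎
  where open ≤-Reasoning

-- Counting distinct values in an interval

module _ {A : Set} where

  unique⇒length≤ : {xs ys : List A} → Unique xs → All (_∈ˡ ys) xs → length xs ≤ length ys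
  unique⇒length≤ [] [] = z≤n
  unique⇒length≤ {x ∷ xs} (x∉xs ∷ xs!) (x∈ys ∷ xs⊆ys) with as , bs , refl ← ∈-∃++ x∈ys = begin
    suc (length xs)               ≤⟨ s≤s (unique⇒length≤ xs! (All.zipWith remove (x∉xs , xs⊆ys))) ⟩
    suc (length (as ++ bs))       ≡⟨ cong suc (length-++ as) ⟩
    suc (length as + length bs)   ≡⟨ +-suc (length as) (length bs) ⟨
    length as + length (x ∷ bs)   ≡⟨ length-++ as ⟨
    length (as ++ x ∷ bs)         ∎
    where
    open ≤-Reasoning
    remove : ∀ {z} → x ≢ z × z ∈ˡ as ++ x ∷ bs → z ∈ˡ as ++ bs
    remove (x≢z , z∈) with ∈-++⁻ as z∈
    ... | inj₁ z∈as             = ∈-++⁺ˡ z∈as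
    ... | inj₂ (Any.here refl)  = contradiction refl x≢z
    ... | inj₂ (Any.there z∈bs) = ∈-++⁺ʳ as z∈bs

unique-bounded⇒length≤ : {xs : List ℕ} → Unique xs → All (λ v → lo ≤ v × v ≤ hi) xs →
                         length xs ≤ suc (hi ∸ lo)
unique-bounded⇒length≤ {lo} {hi} {xs} xs! bounded =
  subst (length xs ≤_) (length-applyUpTo (lo +_) _) (unique⇒length≤ xs! (All.map ∈-interval bounded))
  where
  ∈-interval : ∀ {v} → lo ≤ v × v ≤ hi → v ∈ˡ applyUpTo (lo +_) (suc (hi ∸ lo))
  ∈-interval (lo≤v , v≤hi) =
    subst (_∈ˡ _) (m+[n∸m]≡n lo≤v) (∈-applyUpTo⁺ (lo +_) (s≤s (∸-monoˡ-≤ lo v≤hi)))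

length-concat-tabulate : ∀ {A : Set} {m k} (g : Fin m → List A) → (∀ i → length (g i) ≡ k) →
                         length (concat (tabulate g)) ≡ m * k
length-concat-tabulate {m = zero}  g ∣g∣≡k = refl
length-concat-tabulate {m = suc m} g ∣g∣≡k =
  trans (length-++ (g zero)) (cong₂ _+_ (∣g∣≡k zero) (length-concat-tabulate (g ∘ suc) (∣g∣≡k ∘ suc)))

map⁺-injectiveOn : ∀ {A B : Set} {P : A → Set} {f : A → B} {xs : List A} →
                   (∀ {x y} → P x → P y → x ≢ y → f x ≢ f y) →
                   All P xs → Unique xs → Unique (map f xs)
map⁺-injectiveOn inj []         []           = []
map⁺-injectiveOn inj (px ∷ pxs) (x∉xs ∷ xs!) =
  All.map⁺ (All.zipWith (λ (py , x≢y) → inj px py x≢y) (pxs , x∉xs)) ∷ map⁺-injectiveOn inj pxs xs!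

∈⇒≤foldr-⊔ : ∀ {x xs} d → x ∈ˡ xs → x ≤ foldr _⊔_ d xs
∈⇒≤foldr-⊔ d (Any.here refl)  = m≤m⊔n _ _
∈⇒≤foldr-⊔ d (Any.there x∈xs) = ≤-trans (∈⇒≤foldr-⊔ d x∈xs) (m≤n⊔m _ _)

∈⇒foldr-⊓≤ : ∀ {x xs} d → x ∈ˡ xs → foldr _⊓_ d xs ≤ x
∈⇒foldr-⊓≤ d (Any.here refl)  = m⊓n≤m _ _
∈⇒foldr-⊓≤ d (Any.there x∈xs) = ≤-trans (m⊓n≤n _ _) (∈⇒foldr-⊓≤ d x∈xs)

f≤maxVal : (f : Fin n → ℕ) (v : Fin n) → f v ≤ maxVal f
f≤maxVal f v = ∈⇒≤foldr-⊔ 0 (∈-map⁺ f (∈-allFin v))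

minVal≤f : (f : Fin n → ℕ) (v : Fin n) → minVal f ≤ f v
minVal≤f f v = ∈⇒foldr-⊓≤ (maxVal f) (∈-map⁺ f (∈-allFin v))

maxVal≤ : ∀ {k} (f : Fin n → ℕ) → (∀ v → f v ≤ k) → maxVal f ≤ k
maxVal≤ {n} {k} f f≤k = foldr-preservesᵇ {P = _≤ k} ⊔-lub z≤n (All.map⁺ (All.universal f≤k (allFin n)))

-- Enumerating and ranking the elements of a subset

elements : Subset n → List (Fin n)
elements []          = []
elements (true  ∷ p) = zero ∷ map suc (elements p)
elements (false ∷ p) = map suc (elements p)

length-elements : (p : Subset n) → length (elements p) ≡ ∣ p ∣
length-elements []          = refl
length-elements (true  ∷ p) = cong suc (trans (length-map suc (elements p)) (length-elements p))
length-elements (false ∷ p) = trans (length-map suc (elements p)) (length-elements p)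

elements-unique : (p : Subset n) → Unique (elements p)
elements-unique []          = []
elements-unique (true  ∷ p) =
  All.map⁺ (All.universal (λ _ ()) (elements p)) ∷ Unique.map⁺ Fin.suc-injective (elements-unique p)
elements-unique (false ∷ p) = Unique.map⁺ Fin.suc-injective (elements-unique p)

∈-elements⁻ : (p : Subset n) {x : Fin n} → x ∈ˡ elements p → x ∈ p
∈-elements⁻ (true  ∷ p) (Any.here refl) = here
∈-elements⁻ (true  ∷ p) (Any.there x∈)  with _ , y∈ , refl ← ∈-map⁻ suc x∈ = there (∈-elements⁻ p y∈)
∈-elements⁻ (false ∷ p) x∈              with _ , y∈ , refl ← ∈-map⁻ suc x∈ = there (∈-elements⁻ p y∈)

rank : Subset n → Fin n → ℕ
rank (_     ∷ p) zero    = 0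
rank (true  ∷ p) (suc x) = suc (rank p x)
rank (false ∷ p) (suc x) = rank p x

rank<∣p∣ : (p : Subset n) {x : Fin n} → x ∈ p → rank p x < ∣ p ∣
rank<∣p∣ (true  ∷ p) here        = s≤s z≤n
rank<∣p∣ (true  ∷ p) (there x∈p) = s≤s (rank<∣p∣ p x∈p)
rank<∣p∣ (false ∷ p) (there x∈p) = rank<∣p∣ p x∈p

rank-injective : (p : Subset n) {x y : Fin n} → x ∈ p → y ∈ p → rank p x ≡ rank p y → x ≡ y
rank-injective (_     ∷ p) here        here        _  = refl
rank-injective (true  ∷ p) (there x∈p) (there y∈p) eq = cong suc (rank-injective p x∈p y∈p (suc-injective eq))
rank-injective (false ∷ p) (there x∈p) (there y∈p) eq = cong suc (rank-injective p x∈p y∈p eq)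

∣p∣≡∣p∩q∣+∣p─q∣ : (p q : Subset n) → ∣ p ∣ ≡ ∣ p ∩ q ∣ + ∣ p ─ q ∣
∣p∣≡∣p∩q∣+∣p─q∣ []          []          = refl
∣p∣≡∣p∩q∣+∣p─q∣ (true  ∷ p) (true  ∷ q) = cong suc (∣p∣≡∣p∩q∣+∣p─q∣ p q)
∣p∣≡∣p∩q∣+∣p─q∣ (true  ∷ p) (false ∷ q) = trans (cong suc (∣p∣≡∣p∩q∣+∣p─q∣ p q)) (sym (+-suc ∣ p ∩ q ∣ ∣ p ─ q ∣))
∣p∣≡∣p∩q∣+∣p─q∣ (false ∷ p) (true  ∷ q) = ∣p∣≡∣p∩q∣+∣p─q∣ p q
∣p∣≡∣p∩q∣+∣p─q∣ (false ∷ p) (false ∷ q) = ∣p∣≡∣p∩q∣+∣p─q∣ p q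

x∈p─q⇒x∉q : (p q : Subset n) {x : Fin n} → x ∈ p ─ q → x ∉ q
x∈p─q⇒x∉q (true ∷ p) (false ∷ q) here      ()
x∈p─q⇒x∉q (_    ∷ p) (_     ∷ q) (there x∈) (there x∈q) = x∈p─q⇒x∉q p q x∈ x∈q

0<∣p∣⇒Nonempty : (p : Subset n) → 0 < ∣ p ∣ → Nonempty p
0<∣p∣⇒Nonempty {n} p 0<∣p∣ with nonempty? p
... | yes nonempty = nonempty
... | no  empty    = contradiction (trans (cong ∣_∣ (Empty-unique empty)) (∣⊥∣≡0 n)) (>⇒≢ 0<∣p∣)

Empty[p─q]⇒p⊆q : (p q : Subset n) → Empty (p ─ q) → p ⊆ q
Empty[p─q]⇒p⊆q p q p─q≡∅ {x} x∈p with x ∈? q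
... | yes x∈q = x∈q
... | no  x∉q = contradiction (x , x∈p∧x∉q⇒x∈p─q x∈p x∉q) p─q≡∅

-- L(2,1)-colourings of star hypergraphs

another : ∀ {k} → 2 ≤ k → (i : Fin k) → ∃ λ j → i ≢ j
another {suc (suc _)} _ zero    = suc zero , λ ()
another {suc (suc _)} _ (suc _) = zero , λ ()
another {suc zero} (s≤s ()) zero

module L21Colouring (H : Hypergraph) (f : Fin (nV H) → ℕ) (f-L21 : IsL21 H f) where

  apart-in-edge : ∀ {u v i} → u ≢ v → u ∈ edge H i → v ∈ edge H i → 2 ≤ ∣ f u - f v ∣
  apart-in-edge u≢v = proj₁ f-L21 _ _ u≢v _

  ∣-∣≢1-in-edge : ∀ {u v i} → u ∈ edge H i → v ∈ edge H i → ∣ f u - f v ∣ ≢ 1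
  ∣-∣≢1-in-edge {u} {v} u∈i v∈i with u Fin.≟ v
  ... | yes refl = λ ∣fu-fu∣≡1 → contradiction (trans (sym (∣n-n∣≡0 (f u))) ∣fu-fu∣≡1) λ ()
  ... | no  u≢v  = λ ∣fu-fv∣≡1 → contradiction (subst (2 ≤_) ∣fu-fv∣≡1 (apart-in-edge u≢v u∈i v∈i)) λ { (s≤s ()) }

module StarHypergraph (H : Hypergraph) {r c : ℕ} (uniform : Uniform H r)
  (C : Subset (nV H)) (∣C∣≡c : ∣ C ∣ ≡ c)
  (star : ∀ i j → i ≢ j → edge H i ∩ edge H j ≡ C)
  (2≤nE : 2 ≤ nE H) (1≤c : 1 ≤ c) where

  R : ℕ
  R = r ∸ c

  K : ℕ
  K = nE H * R + (2 * c ∸ 1)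

  1+K≡m*R+2c : suc K ≡ nE H * R + 2 * c
  1+K≡m*R+2c = suc[m+[2n∸1]]≡m+2n (nE H * R) 1≤c

  centre⊆edge : ∀ i → C ⊆ edge H i
  centre⊆edge i x∈C = let j , i≢j = another 2≤nE i in
    p∩q⊆p (edge H i) (edge H j) (subst (_ ∈_) (sym (star i j i≢j)) x∈C)

  shared⇒centre : ∀ {i j x} → i ≢ j → x ∈ edge H i → x ∈ edge H j → x ∈ C
  shared⇒centre {i} {j} i≢j x∈i x∈j = subst (_ ∈_) (star i j i≢j) (x∈p∩q⁺ (x∈i , x∈j))

  private-edge-unique : ∀ {i j x} → x ∈ edge H i → x ∈ edge H j → x ∉ C → i ≡ j
  private-edge-unique {i} {j} x∈i x∈j x∉C =
    decidable-stable (i Fin.≟ j) (λ i≢j → x∉C (shared⇒centre i≢j x∈i x∈j))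

  edge∩C≡C : ∀ i → edge H i ∩ C ≡ C
  edge∩C≡C i = let j , i≢j = another 2≤nE i in begin
    edge H i ∩ C                     ≡⟨ cong (edge H i ∩_) (star i j i≢j) ⟨
    edge H i ∩ (edge H i ∩ edge H j) ≡⟨ ∩-assoc (edge H i) (edge H i) (edge H j) ⟨
    (edge H i ∩ edge H i) ∩ edge H j ≡⟨ cong (_∩ edge H j) (∩-idem (edge H i)) ⟩
    edge H i ∩ edge H j              ≡⟨ star i j i≢j ⟩
    C                                ∎
    where open ≡-Reasoning

  ∣edge─C∣≡R : ∀ i → ∣ edge H i ─ C ∣ ≡ R
  ∣edge─C∣≡R i = begin
    ∣ edge H i ─ C ∣                          ≡⟨ m+n∸m≡n c _ ⟨
    c + ∣ edge H i ─ C ∣ ∸ c                  ≡⟨ cong (λ z → z + ∣ edge H i ─ C ∣ ∸ c) (trans (cong ∣_∣ (edge∩C≡C i)) ∣C∣≡c) ⟨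
    ∣ edge H i ∩ C ∣ + ∣ edge H i ─ C ∣ ∸ c   ≡⟨ cong (_∸ c) (∣p∣≡∣p∩q∣+∣p─q∣ (edge H i) C) ⟨
    ∣ edge H i ∣ ∸ c                          ≡⟨ cong (_∸ c) (uniform i) ⟩
    R                                         ∎
    where open ≡-Reasoning

  privatesOf : Fin (nE H) → List (Fin (nV H))
  privatesOf i = elements (edge H i ─ C)

  privates : List (Fin (nV H))
  privates = concat (tabulate privatesOf)

  ∈-privates⁻ : ∀ {x} → x ∈ˡ privates → ∃ λ i → x ∈ edge H i ─ C
  ∈-privates⁻ x∈
    with xs , x∈xs , xs∈ ← ∈-concat⁻′ (tabulate privatesOf) x∈
    with i , refl ← ∈-tabulate⁻ {f = privatesOf} xs∈
    = i , ∈-elements⁻ (edge H i ─ C) x∈xs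

  length-privates : length privates ≡ nE H * R
  length-privates = length-concat-tabulate privatesOf (λ i → trans (length-elements (edge H i ─ C)) (∣edge─C∣≡R i))

  privates-unique : Unique privates
  privates-unique = Unique.concat⁺ (All.tabulate⁺ (λ i → elements-unique (edge H i ─ C))) (AllPairs.tabulate⁺ disjoint)
    where
    disjoint : ∀ {i j} → i ≢ j → Disjoint (privatesOf i) (privatesOf j)
    disjoint {i} {j} i≢j (x∈i , x∈j) =
      let x∈i─C = ∈-elements⁻ (edge H i ─ C) x∈i ; x∈j─C = ∈-elements⁻ (edge H j ─ C) x∈j in
      i≢j (private-edge-unique (p─q⊆p _ C x∈i─C) (p─q⊆p _ C x∈j─C) (x∈p─q⇒x∉q (edge H i) C x∈i─C))

  i₀ : Fin (nE H)
  i₀ = fromℕ< (≤-trans (s≤s z≤n) 2≤nE)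

  Covered : Fin (nV H) → Set
  Covered x = ∃ λ i → x ∈ edge H i

  covered : List (Fin (nV H))
  covered = privates ++ elements C

  ∈-covered⇒Covered : ∀ {x} → x ∈ˡ covered → Covered x
  ∈-covered⇒Covered x∈ with ∈-++⁻ privates x∈
  ... | inj₁ x∈P = let i , x∈i─C = ∈-privates⁻ x∈P in i , p─q⊆p _ C x∈i─C
  ... | inj₂ x∈C = i₀ , centre⊆edge i₀ (∈-elements⁻ C x∈C)

  covered-unique : Unique covered
  covered-unique = Unique.++⁺ privates-unique (elements-unique C) λ (x∈P , x∈C) →
    let i , x∈i─C = ∈-privates⁻ x∈P in x∈p─q⇒x∉q (edge H i) C x∈i─C (∈-elements⁻ C x∈C)

  length-covered : length covered ≡ nE H * R + c
  length-covered = trans (length-++ privates) (cong₂ _+_ length-privates (trans (length-elements C) ∣C∣≡c))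

  centre-nonempty : Nonempty C
  centre-nonempty = 0<∣p∣⇒Nonempty C (subst (1 ≤_) (sym ∣C∣≡c) 1≤c)

  private-nonempty : (∀ i j → i ≢ j → ¬ edge H i ⊆ edge H j) → ∀ i → Nonempty (edge H i ─ C)
  private-nonempty unnested i with nonempty? (edge H i ─ C)
  ... | yes nonempty = nonempty
  ... | no  empty    = let j , i≢j = another 2≤nE i in
    ⊥-elim (unnested i j i≢j λ x∈i → centre⊆edge j (Empty[p─q]⇒p⊆q (edge H i) C empty x∈i))

  module LowerBound (unnested : ∀ i j → i ≢ j → ¬ edge H i ⊆ edge H j)
                    {f : Fin (nV H) → ℕ} (f-L21 : IsL21 H f) where

    open L21Colouring H f f-L21

    w₀ : Fin (nV H)
    w₀ = proj₁ centre-nonempty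

    w₀∈C : w₀ ∈ C
    w₀∈C = proj₂ centre-nonempty

    p₀ : Fin (nV H)
    p₀ = proj₁ (private-nonempty unnested i₀)

    p₀∈i₀─C : p₀ ∈ edge H i₀ ─ C
    p₀∈i₀─C = proj₂ (private-nonempty unnested i₀)

    f-injective : ∀ {u v} → Covered u → Covered v → u ≢ v → f u ≢ f v
    f-injective {u} {v} (i , u∈i) (j , v∈j) u≢v with u ∈? C | v ∈? C
    ... | yes u∈C | _       = 2≤∣m-n∣⇒m≢n (apart-in-edge u≢v (centre⊆edge j u∈C) v∈j)
    ... | no  _   | yes v∈C = 2≤∣m-n∣⇒m≢n (apart-in-edge u≢v u∈i (centre⊆edge i v∈C))
    ... | no  u∉C | no  v∉C = 1≤∣m-n∣⇒m≢n
      (proj₂ f-L21 u v u≢v j i w₀ v∈j u∈i (centre⊆edge j w₀∈C) (centre⊆edge i w₀∈C) (w₀≢ u∉C) (w₀≢ v∉C))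
      where
      w₀≢ : ∀ {x} → x ∉ C → w₀ ≢ x
      w₀≢ x∉C w₀≡x = x∉C (subst (_∈ C) w₀≡x w₀∈C)

    f-apart-p₀ : ∀ {a} → a ∈ C → 2 ≤ ∣ f a - f p₀ ∣
    f-apart-p₀ a∈C = apart-in-edge (λ a≡p₀ → x∈p─q⇒x∉q (edge H i₀) C p₀∈i₀─C (subst (_∈ C) a≡p₀ a∈C))
      (centre⊆edge i₀ a∈C) (p─q⊆p _ C p₀∈i₀─C)

    hole : Fin (nV H) → ℕ
    hole a = towards (f a) (f p₀)

    hole-injective : ∀ {a b} → a ∈ C → b ∈ C → a ≢ b → hole a ≢ hole b
    hole-injective {a} {b} a∈C b∈C = towards-injective {f a} {f p₀} {f b} (f-apart-p₀ a∈C) (f-apart-p₀ b∈C)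
      ∘ f-injective (i₀ , centre⊆edge i₀ a∈C) (i₀ , centre⊆edge i₀ b∈C)

    hole≢f : ∀ {a u} → a ∈ C → Covered u → hole a ≢ f u
    hole≢f {a} {u} a∈C (i , u∈i) = towards-≢ {f a} {f p₀} {f u} (f-apart-p₀ a∈C) (∣-∣≢1-in-edge (centre⊆edge i a∈C) u∈i)

    values : List ℕ
    values = map f covered ++ map hole (elements C)

    values-unique : Unique values
    values-unique = Unique.++⁺
      (map⁺-injectiveOn f-injective (All.tabulate ∈-covered⇒Covered) covered-unique)
      (map⁺-injectiveOn hole-injective (All.tabulate (∈-elements⁻ C)) (elements-unique C))
      λ (v∈f , v∈hole) →
        let u , u∈ , v≡fu = ∈-map⁻ f v∈f ; a , a∈ , v≡ha = ∈-map⁻ hole v∈hole in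
        hole≢f (∈-elements⁻ C a∈) (∈-covered⇒Covered u∈) (trans (sym v≡ha) v≡fu)

    values-bounded : All (λ v → minVal f ≤ v × v ≤ maxVal f) values
    values-bounded = All.++⁺
      (All.map⁺ (All.universal (λ u → minVal≤f f u , f≤maxVal f u) covered))
      (All.map⁺ (All.tabulate (hole-bounded ∘ ∈-elements⁻ C)))
      where
      hole-bounded : ∀ {a} → a ∈ C → minVal f ≤ hole a × hole a ≤ maxVal f
      hole-bounded {a} a∈C = let lower , upper = towards-between {f a} {f p₀} (f-apart-p₀ a∈C) in
        ≤-trans (⊓-glb (minVal≤f f a) (minVal≤f f p₀)) lower ,
        ≤-trans upper (⊔-lub (f≤maxVal f a) (f≤maxVal f p₀))

    length-values : length values ≡ suc K
    length-values = begin
      length values                                           ≡⟨ length-++ (map f covered) ⟩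
      length (map f covered) + length (map hole (elements C)) ≡⟨ cong₂ _+_ (length-map f covered) (length-map hole (elements C)) ⟩
      length covered + length (elements C)                    ≡⟨ cong₂ _+_ length-covered (trans (length-elements C) ∣C∣≡c) ⟩
      nE H * R + c + c                                        ≡⟨ +-assoc (nE H * R) c c ⟩
      nE H * R + (c + c)                                      ≡⟨ cong (λ z → nE H * R + (c + z)) (+-identityʳ c) ⟨
      nE H * R + 2 * c                                        ≡⟨ 1+K≡m*R+2c ⟨
      suc K                                                   ∎
      where open ≡-Reasoning

    K≤span : K ≤ span f
    K≤span = ≤-pred (subst (_≤ suc (span f)) length-values (unique-bounded⇒length≤ values-unique values-bounded))

  colouring : Fin (nV H) → ℕ
  colouring v with v ∈? C | Fin.any? (λ i → v ∈? edge H i)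
  ... | yes _ | _           = 2 * rank C v
  ... | no  _ | yes (i , _) = 2 * c + (toℕ i + nE H * rank (edge H i ─ C) v)
  ... | no  _ | no  _       = 0

  colouring-centre : ∀ {v} → v ∈ C → colouring v ≡ 2 * rank C v
  colouring-centre {v} v∈C with v ∈? C | Fin.any? (λ i → v ∈? edge H i)
  ... | yes _   | _ = refl
  ... | no  v∉C | _ = contradiction v∈C v∉C

  colouring-private : ∀ {v i} → v ∈ edge H i → v ∉ C →
                      colouring v ≡ 2 * c + (toℕ i + nE H * rank (edge H i ─ C) v)
  colouring-private {v} {i} v∈i v∉C with v ∈? C | Fin.any? (λ i → v ∈? edge H i)
  ... | yes v∈C | _            = contradiction v∈C v∉C
  ... | no  _   | no  ∄i       = contradiction (i , v∈i) ∄i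
  ... | no  _   | yes (j , v∈j) with refl ← private-edge-unique v∈i v∈j v∉C = refl

  centre-rank<c : ∀ {v} → v ∈ C → rank C v < c
  centre-rank<c v∈C = subst (_ <_) ∣C∣≡c (rank<∣p∣ C v∈C)

  private-rank<R : ∀ {v i} → v ∈ edge H i → v ∉ C → rank (edge H i ─ C) v < R
  private-rank<R {v} {i} v∈i v∉C =
    subst (rank (edge H i ─ C) v <_) (∣edge─C∣≡R i) (rank<∣p∣ (edge H i ─ C) (x∈p∧x∉q⇒x∈p─q v∈i v∉C))

  2+centre≤private : ∀ {u v i} → u ∈ C → v ∈ edge H i → v ∉ C → 2 + colouring u ≤ colouring v
  2+centre≤private {u} {v} {i} u∈C v∈i v∉C = begin
    2 + colouring u                                 ≡⟨ cong (2 +_) (colouring-centre u∈C) ⟩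
    2 + 2 * rank C u                                ≡⟨ *-suc 2 (rank C u) ⟨
    2 * suc (rank C u)                              ≤⟨ *-monoʳ-≤ 2 (centre-rank<c u∈C) ⟩
    2 * c                                           ≤⟨ m≤m+n (2 * c) _ ⟩
    2 * c + (toℕ i + nE H * rank (edge H i ─ C) v)  ≡⟨ colouring-private v∈i v∉C ⟨
    colouring v                                     ∎
    where open ≤-Reasoning

  colouring-apart : ∀ {u v i} → u ≢ v → u ∈ edge H i → v ∈ edge H i →
                    2 ≤ ∣ colouring u - colouring v ∣
  colouring-apart {u} {v} {i} u≢v u∈i v∈i with toSum (u ∈? C) | toSum (v ∈? C)
  ... | inj₁ u∈C | inj₁ v∈C =
    subst₂ (λ x y → 2 ≤ ∣ x - y ∣) (sym (colouring-centre u∈C)) (sym (colouring-centre v∈C))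
      (2≤∣k*m-k*n∣ ≤-refl (u≢v ∘ rank-injective C u∈C v∈C))
  ... | inj₁ u∈C | inj₂ v∉C = 2+m≤n⇒2≤∣m-n∣ (2+centre≤private u∈C v∈i v∉C)
  ... | inj₂ u∉C | inj₁ v∈C =
    subst (2 ≤_) (∣-∣-comm (colouring v) (colouring u)) (2+m≤n⇒2≤∣m-n∣ (2+centre≤private v∈C u∈i u∉C))
  ... | inj₂ u∉C | inj₂ v∉C =
    subst₂ (λ x y → 2 ≤ ∣ x - y ∣) (sym (colouring-private u∈i u∉C)) (sym (colouring-private v∈i v∉C))
      (subst (2 ≤_) (sym (trans (∣m+n-m+o∣≡∣n-o∣ (2 * c) _ _) (∣m+n-m+o∣≡∣n-o∣ (toℕ i) _ _)))
        (2≤∣k*m-k*n∣ 2≤nE (u≢v ∘ rank-injective (edge H i ─ C) (x∈p∧x∉q⇒x∈p─q u∈i u∉C) (x∈p∧x∉q⇒x∈p─q v∈i v∉C))))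

  private-colouring-injective : ∀ {u v i j} → u ∈ edge H i → u ∉ C → v ∈ edge H j → v ∉ C →
                                colouring u ≡ colouring v → u ≡ v
  private-colouring-injective {u} {v} {i} {j} u∈i u∉C v∈j v∉C eq
    with toℕi≡toℕj , ranks≡ ← digits-injective (Fin.toℕ<n i) (Fin.toℕ<n j)
           (+-cancelˡ-≡ (2 * c) _ _ (trans (sym (colouring-private u∈i u∉C)) (trans eq (colouring-private v∈j v∉C))))
    with refl ← Fin.toℕ-injective toℕi≡toℕj
    = rank-injective (edge H i ─ C) (x∈p∧x∉q⇒x∈p─q u∈i u∉C) (x∈p∧x∉q⇒x∈p─q v∈j v∉C) ranks≡

  colouring-injective : ∀ {u v i j} → u ∈ edge H i → v ∈ edge H j → u ≢ v → colouring u ≢ colouring v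
  colouring-injective {u} {v} u∈i v∈j u≢v with toSum (u ∈? C) | toSum (v ∈? C)
  ... | inj₁ u∈C | inj₁ v∈C = λ eq → u≢v (rank-injective C u∈C v∈C
    (*-cancelˡ-≡ _ _ 2 (trans (sym (colouring-centre u∈C)) (trans eq (colouring-centre v∈C)))))
  ... | inj₁ u∈C | inj₂ v∉C = <⇒≢ (≤-trans (n≤1+n _) (2+centre≤private u∈C v∈j v∉C))
  ... | inj₂ u∉C | inj₁ v∈C = ≢-sym (<⇒≢ (≤-trans (n≤1+n _) (2+centre≤private v∈C u∈i u∉C)))
  ... | inj₂ u∉C | inj₂ v∉C = u≢v ∘ private-colouring-injective u∈i u∉C v∈j v∉C

  colouring-L21 : IsL21 H colouring
  colouring-L21 =
    (λ u v u≢v i u∈i v∈i → colouring-apart u≢v u∈i v∈i) ,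
    (λ u v u≢v i j _ v∈i u∈j _ _ _ _ → m≢n⇒1≤∣m-n∣ (colouring-injective u∈j v∈i u≢v))

  colouring≤K : ∀ v → colouring v ≤ K
  colouring≤K v = ≤-pred (subst (colouring v <_) (sym 1+K≡m*R+2c) (colouring<m*R+2c v))
    where
    colouring<m*R+2c : ∀ v → colouring v < nE H * R + 2 * c
    colouring<m*R+2c v with v ∈? C | Fin.any? (λ i → v ∈? edge H i)
    ... | yes v∈C | _ = <-≤-trans (*-monoʳ-< 2 (centre-rank<c v∈C)) (m≤n+m (2 * c) (nE H * R))
    ... | no  v∉C | yes (i , v∈i) = subst (2 * c + (toℕ i + nE H * rank (edge H i ─ C) v) <_) (+-comm (2 * c) (nE H * R))
      (+-monoʳ-< (2 * c) (digits-< (Fin.toℕ<n i) (private-rank<R v∈i v∉C)))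
    ... | no  _   | no  _ = <-≤-trans (*-monoʳ-< 2 1≤c) (m≤n+m (2 * c) (nE H * R))

  span-colouring≤K : span colouring ≤ K
  span-colouring≤K = ≤-trans (m∸n≤m (maxVal colouring) (minVal colouring)) (maxVal≤ colouring colouring≤K)

mainTheorem10 : (H : Hypergraph) (r c : ℕ) → Simple H → Uniform H r → IsStar H c →
    2 ≤ nE H → 1 ≤ c →
    IsLambda H (nE H * (r ∸ c) + (2 * c ∸ 1))
mainTheorem10 H r c (_ , unnested) uniform (C , ∣C∣≡c , star) 2≤nE 1≤c =
  (colouring , colouring-L21 , ≤-antisym span-colouring≤K (K≤span colouring-L21)) ,
  λ _ → K≤span
  where
  open StarHypergraph H uniform C ∣C∣≡c star 2≤nE 1≤c
  open LowerBound unnested using (K≤span)
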